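{- In the Hopf algebra $\mathbf H_o$ with basis $\{S^{\mathcal F}\}$ indexed by ordered forests, define for each ordered forest $\mathcal F$ $$R_{\mathcal F}=\sum_{\mathcal G\le\mathcal F}(-1)^{|E(\mathcal F)|-|E(\mathcal G)|}S^{\mathcal G}.$$ Let $\mathcal F'$ and $\mathcal F''$ be ordered forests with $k'$ and $k''$ vertices respectively. Then $$R_{\mathcal F'}R_{\mathcal F''}=\sum R_{\mathcal F},$$ where the sum is over all ordered forests $\mathcal F$ with $k'+k''$ vertices such that $\mathcal F_{\mid\{1,\dots,k'\}}=\mathcal F'$ and $\mathcal F_{\mid\{k'+1,\dots,k'+k''\}}=\mathcal F''$.
   Context: An ordered forest on $[n]$ is a rooted forest with vertex set $[n]=\{1,\dots,n\}$; its edges $E(\mathcal F)$ are regarded as elements of $[n]^2$ (pairs (child, parent)). The product of $\mathbf H_o$ is $S^{\mathcal F}S^{\mathcal G}=S^{\mathcal F\mathcal G}$ where, for $\mathcal F$ on $[n]$, $\mathcal F\mathcal G$ is the disjoint union of $\mathcal F$ and $\mathcal G$ with labels shifted by $n$. The partial order on ordered forests with $n$ vertices: $\mathcal G\le\mathcal F$ iff $E(\mathcal F)\subseteq E(\mathcal G)$ (so $\mathcal F$ is obtained from $\mathcal G$ by deleting edges). For $I\subseteq[k]$, the restriction $\mathcal F_{\mid I}$ is the subforest with vertex set $I$ and all edges of $\mathcal F$ between vertices of $I$, made an ordered forest on $[|I|]$ by order-preserving relabelling. -}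

module Defs where

open import Data.Nat using (ℕ; zero; suc; _+_; _∸_)
open import Data.Integer using (ℤ; 0ℤ; 1ℤ; -_; _*_) renaming (_+_ to _+ℤ_; _^_ to _^ℤ_)
open import Data.Fin using (Fin; _↑ˡ_; _↑ʳ_; splitAt)
open import Data.Fin.Properties using (all?) renaming (_≟_ to _≟F_)
open import Data.Maybe using (Maybe; nothing; just)
import Data.Maybe as Maybe
import Data.Maybe.Properties as MaybeP
open import Data.Vec using (Vec; []; _∷_; lookup; tabulate; _++_)
import Data.Vec as Vec
import Data.Vec.Properties as VecP
open import Data.List using (List; []; _∷_; [_]; concatMap; mapMaybe; allFin; filter; foldr)
import Data.List as List
open import Data.Sum using (inj₁; inj₂)
open import Data.Product using (_×_)
open import Data.Unit using (⊤; tt)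
open import Relation.Binary.PropositionalEquality using (_≡_; refl)
open import Relation.Nullary using (Dec; yes; no; ⌊_⌋)
open import Relation.Nullary.Decidable using (_×-dec_)
open import Data.Bool using (Bool; if_then_else_)

-- Ordered forests on [n] = Fin n (vertex i+1 of the paper is Fin index i).
-- A rooted forest is encoded by its parent map: parent i = just j means
-- (i , j) is an edge (child , parent); nothing means i is a root.

ParentVec : ℕ → Set
ParentVec n = Vec (Maybe (Fin n)) n

step : ∀ {n} → ParentVec n → Maybe (Fin n) → Maybe (Fin n)
step v nothing  = nothing
step v (just i) = lookup v i

iter : ∀ {A : Set} → (A → A) → ℕ → A → A
iter f zero    x = x
iter f (suc m) x = f (iter f m x)

IsAcyclic : ∀ {n} → ParentVec n → Set
IsAcyclic {n} v = ∀ i → iter (step v) n (just i) ≡ nothing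

acyclic? : ∀ {n} (v : ParentVec n) → Dec (IsAcyclic v)
acyclic? {n} v = all? (λ i → MaybeP.≡-dec _≟F_ (iter (step v) n (just i)) nothing)

record Forest (n : ℕ) : Set where
  constructor forest
  field
    parent  : ParentVec n
    acyclic : IsAcyclic parent
open Forest public

edgeCount : ∀ {m n} → Vec (Maybe (Fin n)) m → ℕ
edgeCount []             = 0
edgeCount (nothing ∷ v)  = edgeCount v
edgeCount (just _ ∷ v)   = suc (edgeCount v)

∣E∣ : ∀ {n} → Forest n → ℕ
∣E∣ F = edgeCount (parent F)

-- edge (i , j) of F is an edge of G
EdgeIn : ∀ {n} → Maybe (Fin n) → Maybe (Fin n) → Set
EdgeIn nothing  y = ⊤
EdgeIn (just j) y = y ≡ just j

edgeIn? : ∀ {n} (x y : Maybe (Fin n)) → Dec (EdgeIn x y)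
edgeIn? nothing  y = yes tt
edgeIn? (just j) y = MaybeP.≡-dec _≟F_ y (just j)

-- G ≤ F  iff  E(F) ⊆ E(G)
_≤F_ : ∀ {n} → Forest n → Forest n → Set
G ≤F F = ∀ i → EdgeIn (lookup (parent F) i) (lookup (parent G) i)

_≤F?_ : ∀ {n} (G F : Forest n) → Dec (G ≤F F)
G ≤F? F = all? (λ i → edgeIn? (lookup (parent F) i) (lookup (parent G) i))

allVecs : ∀ {A : Set} → List A → (n : ℕ) → List (Vec A n)
allVecs xs zero    = [ [] ]
allVecs xs (suc n) = concatMap (λ x → List.map (x ∷_) (allVecs xs n)) xs

allParentVecs : (n : ℕ) → List (ParentVec n)
allParentVecs n = allVecs (nothing ∷ List.map just (allFin n)) n

toForest : ∀ {n} → ParentVec n → Maybe (Forest n)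
toForest v with acyclic? v
... | yes p = just (forest v p)
... | no _  = nothing

forests : (n : ℕ) → List (Forest n)
forests n = mapMaybe toForest (allParentVecs n)

concatPV : ∀ {k' k''} → ParentVec k' → ParentVec k'' → ParentVec (k' + k'')
concatPV {k'} {k''} v w =
  Vec.map (Maybe.map (_↑ˡ k'')) v ++ Vec.map (Maybe.map (k' ↑ʳ_)) w

restrictL : ∀ k' {k''} → ParentVec (k' + k'') → ParentVec k'
restrictL k' {k''} v = tabulate λ i → keep (lookup v (i ↑ˡ k''))
  where
  keep : Maybe (Fin (k' + k'')) → Maybe (Fin k')
  keep nothing = nothing
  keep (just j) with splitAt k' j
  ... | inj₁ j' = just j'
  ... | inj₂ _  = nothing

restrictR : ∀ k' {k''} → ParentVec (k' + k'') → ParentVec k''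
restrictR k' {k''} v = tabulate λ i → keep (lookup v (k' ↑ʳ i))
  where
  keep : Maybe (Fin (k' + k'')) → Maybe (Fin k'')
  keep nothing = nothing
  keep (just j) with splitAt k' j
  ... | inj₁ _  = nothing
  ... | inj₂ j' = just j'

-- The Hopf algebra H_o (over ℤ), degree-n homogeneous part:
-- an element is its coefficient function on the basis {S^F : F forest on [n]}.

Hₒ : ℕ → Set
Hₒ n = Forest n → ℤ

_≟PV_ : ∀ {n} (v w : ParentVec n) → Dec (v ≡ w)
_≟PV_ = VecP.≡-dec (MaybeP.≡-dec _≟F_)

S : ∀ {n} → Forest n → Hₒ n
S F G = if ⌊ parent G ≟PV parent F ⌋ then 1ℤ else 0ℤ

0H : ∀ {n} → Hₒ n
0H _ = 0ℤ

_⊕_ : ∀ {n} → Hₒ n → Hₒ n → Hₒ n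
(a ⊕ b) G = a G +ℤ b G

_·ℤ_ : ∀ {n} → ℤ → Hₒ n → Hₒ n
(c ·ℤ a) G = c * a G

ΣH : ∀ {A : Set} {n} → List A → (A → Hₒ n) → Hₒ n
ΣH xs f = foldr (λ x acc → f x ⊕ acc) 0H xs

-- bilinear extension of S^F S^G = S^{FG}
_·_ : ∀ {k' k''} → Hₒ k' → Hₒ k'' → Hₒ (k' + k'')
_·_ {k'} {k''} a b H =
  foldr _+ℤ_ 0ℤ (List.map (λ F → foldr _+ℤ_ 0ℤ (List.map (λ G →
      if ⌊ concatPV (parent F) (parent G) ≟PV parent H ⌋ then a F * b G else 0ℤ)
    (forests k''))) (forests k'))

-- R_F = Σ_{G ≤ F} (-1)^{|E(F)|-|E(G)|} S^G   (|E(G)| ≥ |E(F)|, same parity)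
R : ∀ {n} → Forest n → Hₒ n
R {n} F = ΣH (filter (λ G → G ≤F? F) (forests n))
             (λ G → ((- 1ℤ) ^ℤ (∣E∣ G ∸ ∣E∣ F)) ·ℤ S G)

Restricts : ∀ {k' k''} → Forest k' → Forest k'' → Forest (k' + k'') → Set
Restricts {k'} F' F'' F =
  (restrictL k' (parent F) ≡ parent F') × (restrictR k' (parent F) ≡ parent F'')

restricts? : ∀ {k' k''} (F' : Forest k') (F'' : Forest k'') (F : Forest (k' + k'')) →
             Dec (Restricts F' F'' F)
restricts? {k'} F' F'' F =
  (restrictL k' (parent F) ≟PV parent F') ×-dec (restrictR k' (parent F) ≟PV parent F'')

module Submission where

-- Both sides are evaluated at a basis forest H and computed coordinatewise.
-- The coefficient of S^G in R_F is the Möbius function μ(G, F) of the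
-- edge-inclusion order, and μ factors over the vertices as a product of
-- one-slot weights μ₁ (a slot is the parent of a vertex, or "root").
-- Forests are parent vectors that are acyclic; every sum below has a
-- summand vanishing on cyclic vectors (concatenation and sub-forests of the
-- forest H are acyclic), so it may be taken over ALL parent vectors, and a
-- sum over all vectors of a product of slot weights is the product of the
-- slot sums.  Hence both sides become ∏_{a ≤ k'} (…) · ∏_{b ≤ k''} (…),
-- and the theorem reduces to a two-line identity between slot sums
-- ('slot-identity'), transported along the inclusions [k'], [k''] → [k'+k''].

open import Defs
open import Data.Nat using (ℕ; zero; suc; _+_; _∸_; _≤_; _<_; _≤′_; ≤′-refl; ≤′-step; z≤n; s≤s)
import Data.Nat.Properties as ℕP
open import Data.Integer using (ℤ; 0ℤ; 1ℤ; -1ℤ; -_; _*_; _-_) renaming (_+_ to _+ℤ_; _^_ to _^ℤ_)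
open import Data.Integer.Properties
  using (+-identityˡ; +-identityʳ; +-assoc; +-comm; +-inverseʳ; *-identityˡ; *-identityʳ;
         *-zeroʳ; *-assoc; *-comm; *-distribˡ-+; -1*i≡-i; *-1-commutativeMonoid; *-commutativeSemigroup)
open import Data.Fin using (Fin; zero; suc; toℕ; _↑ˡ_; _↑ʳ_; splitAt)
import Data.Fin.Properties as FinP
open import Data.Fin.Properties using (all?) renaming (_≟_ to _≟F_)
open import Data.List using (List; []; _∷_; allFin; filter; foldr; mapMaybe; concatMap; _++_)
import Data.List as List
import Data.List.Properties as ListP
open import Data.Maybe using (Maybe; nothing; just; maybe; fromMaybe; _>>=_)
import Data.Maybe as Maybe
import Data.Maybe.Properties as MaybeP
open import Data.Vec using (Vec; []; _∷_; lookup)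
import Data.Vec as Vec
import Data.Vec.Properties as VecP
open import Data.Product using (_×_; _,_; proj₁; proj₂; ∃-syntax)
open import Data.Sum using (inj₁; inj₂; [_,_])
open import Data.Unit using (tt)
open import Data.Empty using (⊥-elim)
open import Data.Bool using (true; false; if_then_else_)
open import Function using (_∘_; _∋_; const; _⇔_; mk⇔; Equivalence)
open import Relation.Nullary using (Dec; yes; no; does; ⌊_⌋; ¬_)
open import Relation.Nullary.Decidable using (_×-dec_; dec-true; dec-false)
open import Relation.Binary.Definitions using (DecidableEquality)
open import Relation.Binary.PropositionalEquality
  using (_≡_; _≢_; refl; sym; trans; cong; cong₂; subst; module ≡-Reasoning)
import Algebra.Properties.CommutativeMonoid.Sum *-1-commutativeMonoid as Product
open import Algebra.Properties.CommutativeSemigroup *-commutativeSemigroup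
  using (interchange; x∙yz≈y∙xz; x∙yz≈z∙xy)

private
  variable
    A B : Set
    k m n N : ℕ

-- 𝟙 d is 1 or 0 according to d; its boolean part makes it compute
-- definitionally through the library's deciders (map′, ×-dec, all?).
𝟙 : ∀ {p} {P : Set p} → Dec P → ℤ
𝟙 d = if does d then 1ℤ else 0ℤ

𝟙-yes : ∀ {p} {P : Set p} → P → (d : Dec P) → 𝟙 d ≡ 1ℤ
𝟙-yes p d = cong (if_then 1ℤ else 0ℤ) (dec-true d p)

𝟙-no : ∀ {p} {P : Set p} → ¬ P → (d : Dec P) → 𝟙 d ≡ 0ℤ
𝟙-no ¬p d = cong (if_then 1ℤ else 0ℤ) (dec-false d ¬p)

𝟙-⇔ : ∀ {p q} {P : Set p} {Q : Set q} → P ⇔ Q → (d : Dec P) (e : Dec Q) → 𝟙 d ≡ 𝟙 e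
𝟙-⇔ P⇔Q (yes p) e = sym (𝟙-yes (Equivalence.to P⇔Q p) e)
𝟙-⇔ P⇔Q (no ¬p) e = sym (𝟙-no (¬p ∘ Equivalence.from P⇔Q) e)

𝟙-× : ∀ {p q} {P : Set p} {Q : Set q} (d : Dec P) (e : Dec Q) → 𝟙 (d ×-dec e) ≡ 𝟙 d * 𝟙 e
𝟙-× (yes _) e = sym (*-identityˡ (𝟙 e))
𝟙-× (no _)  e = refl

if-then-0 : ∀ {p} {P : Set p} (d : Dec P) (x : ℤ) → (if ⌊ d ⌋ then x else 0ℤ) ≡ 𝟙 d * x
if-then-0 (yes _) x = sym (*-identityˡ x)
if-then-0 (no _)  x = refl

-- Finite sums over lists (the same fold as in the product of Hₒ)

∑ : List A → (A → ℤ) → ℤ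
∑ xs f = foldr _+ℤ_ 0ℤ (List.map f xs)

infix 5 ∑
syntax ∑ xs (λ x → e) = ∑[ x ∈ xs ] e

∑-cong : (xs : List A) {f g : A → ℤ} → (∀ x → f x ≡ g x) → ∑ xs f ≡ ∑ xs g
∑-cong []       f≗g = refl
∑-cong (x ∷ xs) f≗g = cong₂ _+ℤ_ (f≗g x) (∑-cong xs f≗g)

∑-zero : (xs : List A) (f : A → ℤ) → (∀ x → f x ≡ 0ℤ) → ∑ xs f ≡ 0ℤ
∑-zero []       f f≡0 = refl
∑-zero (x ∷ xs) f f≡0 = cong₂ _+ℤ_ (f≡0 x) (∑-zero xs f f≡0)

∑-++ : (xs ys : List A) (f : A → ℤ) → ∑ (xs ++ ys) f ≡ ∑ xs f +ℤ ∑ ys f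
∑-++ []       ys f = sym (+-identityˡ (∑ ys f))
∑-++ (x ∷ xs) ys f =
  trans (cong (f x +ℤ_) (∑-++ xs ys f)) (sym (+-assoc (f x) _ _))

∑-map : (h : A → B) (xs : List A) (f : B → ℤ) → ∑ (List.map h xs) f ≡ ∑ xs (f ∘ h)
∑-map h xs f = cong (foldr _+ℤ_ 0ℤ) (sym (ListP.map-∘ xs))

∑-concatMap : (h : A → List B) (xs : List A) (f : B → ℤ) →
              ∑ (concatMap h xs) f ≡ ∑[ x ∈ xs ] ∑ (h x) f
∑-concatMap h []       f = refl
∑-concatMap h (x ∷ xs) f = trans (∑-++ (h x) _ f) (cong (∑ (h x) f +ℤ_) (∑-concatMap h xs f))

∑-mapMaybe : (h : A → Maybe B) (xs : List A) (f : B → ℤ) →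
             ∑ (mapMaybe h xs) f ≡ ∑[ x ∈ xs ] maybe f 0ℤ (h x)
∑-mapMaybe h []       f = refl
∑-mapMaybe h (x ∷ xs) f with h x
... | nothing = trans (∑-mapMaybe h xs f) (sym (+-identityˡ _))
... | just y  = cong (f y +ℤ_) (∑-mapMaybe h xs f)

∑-filter : ∀ {p} {P : A → Set p} (P? : ∀ x → Dec (P x)) (xs : List A) (f : A → ℤ) →
           ∑ (filter P? xs) f ≡ ∑[ x ∈ xs ] 𝟙 (P? x) * f x
∑-filter P? []       f = refl
∑-filter P? (x ∷ xs) f with does (P? x)
... | true  = cong₂ _+ℤ_ (sym (*-identityˡ (f x))) (∑-filter P? xs f)
... | false = trans (∑-filter P? xs f) (sym (+-identityˡ _))

∑-tabulate : (g : Fin n → A) (f : A → ℤ) → ∑ (List.tabulate g) f ≡ ∑ (allFin n) (f ∘ g)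
∑-tabulate g f = cong (foldr _+ℤ_ 0ℤ)
  (trans (ListP.map-tabulate g f) (sym (ListP.map-tabulate (λ i → i) (f ∘ g))))

∑-*ˡ : (c : ℤ) (xs : List A) (f : A → ℤ) → c * ∑ xs f ≡ ∑[ x ∈ xs ] c * f x
∑-*ˡ c []       f = *-zeroʳ c
∑-*ˡ c (x ∷ xs) f = trans (*-distribˡ-+ c (f x) _) (cong (c * f x +ℤ_) (∑-*ˡ c xs f))

∑-*ʳ : (c : ℤ) (xs : List A) (f : A → ℤ) → ∑ xs f * c ≡ ∑[ x ∈ xs ] f x * c
∑-*ʳ c xs f = trans (*-comm _ c) (trans (∑-*ˡ c xs f) (∑-cong xs (λ x → *-comm c (f x))))

∑∑-separate : (xs : List A) (ys : List B) (X : A → ℤ) (Y : B → ℤ) →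
              ∑[ v ∈ xs ] ∑[ w ∈ ys ] X v * Y w ≡ ∑ xs X * ∑ ys Y
∑∑-separate xs ys X Y =
  trans (∑-cong xs (λ v → sym (∑-*ˡ (X v) ys Y))) (sym (∑-*ʳ (∑ ys Y) xs X))

-- Products over Fin n (the library's monoid sum, for multiplication)

∏ : ∀ n → (Fin n → ℤ) → ℤ
∏ n f = Product.sum f

infixl 10 ∏
syntax ∏ n (λ i → e) = ∏[ i < n ] e

∏-cong : (f g : Fin n → ℤ) → (∀ i → f i ≡ g i) → ∏ n f ≡ ∏ n g
∏-cong f g f≗g = Product.sum-cong-≗ f≗g

∏-* : (f g : Fin n → ℤ) → ∏[ i < n ] (f i * g i) ≡ ∏ n f * ∏ n g
∏-* = Product.∑-distrib-+

∏-split : ∀ m n (f : Fin (m + n) → ℤ) → ∏ (m + n) f ≡ ∏[ a < m ] f (a ↑ˡ n) * ∏[ b < n ] f (m ↑ʳ b)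
∏-split zero    n f = sym (*-identityˡ _)
∏-split (suc m) n f = trans (cong (f zero *_) (∏-split m n (f ∘ suc))) (sym (*-assoc (f zero) _ _))

∏-interchange : (f g : Fin m → ℤ) (f′ g′ : Fin n → ℤ) →
                (∏ m f * ∏ n f′) * (∏ m g * ∏ n g′) ≡ ∏[ a < m ] (f a * g a) * ∏[ b < n ] (f′ b * g′ b)
∏-interchange f g f′ g′ =
  trans (interchange (∏ _ f) (∏ _ f′) (∏ _ g) (∏ _ g′)) (sym (cong₂ _*_ (∏-* f g) (∏-* f′ g′)))

𝟙-vec-eq : (_≟_ : DecidableEquality A) (xs ys : Vec A n) →
           𝟙 (VecP.≡-dec _≟_ xs ys) ≡ ∏[ i < n ] 𝟙 (lookup xs i ≟ lookup ys i)
𝟙-vec-eq _≟_ []       []       = refl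
𝟙-vec-eq _≟_ (x ∷ xs) (y ∷ ys) =
  trans (𝟙-× (x ≟ y) (VecP.≡-dec _≟_ xs ys)) (cong (𝟙 (x ≟ y) *_) (𝟙-vec-eq _≟_ xs ys))

-- Enumerations: xs lists every element of A exactly once, expressed as the
-- sifting property of the Kronecker delta.

Enumerates : DecidableEquality A → List A → Set
Enumerates {A} _≟_ xs = ∀ (a : A) (g : A → ℤ) → ∑[ x ∈ xs ] 𝟙 (a ≟ x) * g x ≡ g a

allFin-enumerates : ∀ n → Enumerates _≟F_ (allFin n)
allFin-enumerates (suc n) zero g = begin
  1ℤ * g zero +ℤ ∑ (List.tabulate suc) (λ x → 𝟙 (zero ≟F x) * g x)
    ≡⟨ cong₂ _+ℤ_ (*-identityˡ (g zero)) (∑-tabulate suc (λ x → 𝟙 (zero ≟F x) * g x)) ⟩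
  g zero +ℤ ∑ (allFin n) (const 0ℤ)
    ≡⟨ cong (g zero +ℤ_) (∑-zero (allFin n) _ (λ _ → refl)) ⟩
  g zero +ℤ 0ℤ
    ≡⟨ +-identityʳ (g zero) ⟩
  g zero ∎
  where open ≡-Reasoning
allFin-enumerates (suc n) (suc a) g = begin
  0ℤ +ℤ ∑ (List.tabulate suc) (λ x → 𝟙 (suc a ≟F x) * g x)
    ≡⟨ +-identityˡ _ ⟩
  ∑ (List.tabulate suc) (λ x → 𝟙 (suc a ≟F x) * g x)
    ≡⟨ ∑-tabulate suc (λ x → 𝟙 (suc a ≟F x) * g x) ⟩
  ∑[ x ∈ allFin n ] 𝟙 (a ≟F x) * g (suc x)
    ≡⟨ allFin-enumerates n a (g ∘ suc) ⟩
  g (suc a) ∎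
  where open ≡-Reasoning

maybe-enumerates : {_≟_ : DecidableEquality A} {xs : List A} → Enumerates _≟_ xs →
                   Enumerates (MaybeP.≡-dec _≟_) (nothing ∷ List.map just xs)
maybe-enumerates {xs = xs} enum nothing g = begin
  1ℤ * g nothing +ℤ ∑ (List.map just xs) (λ x → 𝟙 (MaybeP.≡-dec _ nothing x) * g x)
    ≡⟨ cong₂ _+ℤ_ (*-identityˡ (g nothing)) (∑-map just xs _) ⟩
  g nothing +ℤ ∑ xs (const 0ℤ)
    ≡⟨ cong (g nothing +ℤ_) (∑-zero xs _ (λ _ → refl)) ⟩
  g nothing +ℤ 0ℤ
    ≡⟨ +-identityʳ (g nothing) ⟩
  g nothing ∎
  where open ≡-Reasoning
maybe-enumerates {_≟_ = _≟_} {xs} enum (just a) g = begin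
  0ℤ +ℤ ∑ (List.map just xs) (λ x → 𝟙 (MaybeP.≡-dec _≟_ (just a) x) * g x)
    ≡⟨ +-identityˡ _ ⟩
  ∑ (List.map just xs) (λ x → 𝟙 (MaybeP.≡-dec _≟_ (just a) x) * g x)
    ≡⟨ ∑-map just xs _ ⟩
  ∑[ x ∈ xs ] 𝟙 (a ≟ x) * g (just x)
    ≡⟨ enum a (g ∘ just) ⟩
  g (just a) ∎
  where open ≡-Reasoning

∑-allVecs-suc : (xs : List A) (φ : Vec A (suc n) → ℤ) →
                ∑ (allVecs xs (suc n)) φ ≡ ∑[ x ∈ xs ] ∑[ v ∈ allVecs xs n ] φ (x ∷ v)
∑-allVecs-suc {n = n} xs φ =
  trans (∑-concatMap _ xs φ) (∑-cong xs (λ x → ∑-map (x ∷_) (allVecs xs n) φ))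

vecs-enumerates : {_≟_ : DecidableEquality A} {xs : List A} → Enumerates _≟_ xs →
                  ∀ n → Enumerates (VecP.≡-dec _≟_) (allVecs xs n)
vecs-enumerates enum zero    [] g = trans (+-identityʳ _) (*-identityˡ (g []))
vecs-enumerates {_≟_ = _≟_} {xs} enum (suc n) (a ∷ as) g = begin
  ∑ (allVecs xs (suc n)) (λ v → 𝟙 (VecP.≡-dec _≟_ (a ∷ as) v) * g v)
    ≡⟨ ∑-allVecs-suc xs _ ⟩
  ∑[ x ∈ xs ] ∑[ v ∈ allVecs xs n ] 𝟙 ((a ≟ x) ×-dec VecP.≡-dec _≟_ as v) * g (x ∷ v)
    ≡⟨ ∑-cong xs (λ x → ∑-cong (allVecs xs n) (λ v →
         trans (cong (_* g (x ∷ v)) (𝟙-× (a ≟ x) (VecP.≡-dec _≟_ as v))) (*-assoc (𝟙 (a ≟ x)) _ _))) ⟩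
  ∑[ x ∈ xs ] ∑[ v ∈ allVecs xs n ] 𝟙 (a ≟ x) * (𝟙 (VecP.≡-dec _≟_ as v) * g (x ∷ v))
    ≡⟨ ∑-cong xs (λ x → trans (sym (∑-*ˡ (𝟙 (a ≟ x)) (allVecs xs n) _))
                              (cong (𝟙 (a ≟ x) *_) (vecs-enumerates enum n as (g ∘ (x ∷_))))) ⟩
  ∑[ x ∈ xs ] 𝟙 (a ≟ x) * g (x ∷ as)
    ≡⟨ enum a (λ x → g (x ∷ as)) ⟩
  g (a ∷ as) ∎
  where open ≡-Reasoning

∑-∏ : (xs : List A) (n : ℕ) (f : Fin n → A → ℤ) →
      ∑[ v ∈ allVecs xs n ] ∏[ i < n ] f i (lookup v i) ≡ ∏[ i < n ] ∑ xs (f i)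
∑-∏ xs zero    f = +-identityʳ 1ℤ
∑-∏ xs (suc n) f = begin
  ∑[ v ∈ allVecs xs (suc n) ] ∏[ i < suc n ] f i (lookup v i)
    ≡⟨ ∑-allVecs-suc xs _ ⟩
  ∑[ x ∈ xs ] ∑[ v ∈ allVecs xs n ] f zero x * ∏[ i < n ] f (suc i) (lookup v i)
    ≡⟨ ∑-cong xs (λ x → sym (∑-*ˡ (f zero x) (allVecs xs n) _)) ⟩
  ∑[ x ∈ xs ] f zero x * (∑[ v ∈ allVecs xs n ] ∏[ i < n ] f (suc i) (lookup v i))
    ≡⟨ ∑-cong xs (λ x → cong (f zero x *_) (∑-∏ xs n (f ∘ suc))) ⟩
  ∑[ x ∈ xs ] f zero x * ∏[ i < n ] ∑ xs (f (suc i))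
    ≡⟨ sym (∑-*ʳ _ xs (f zero)) ⟩
  ∑ xs (f zero) * ∏[ i < n ] ∑ xs (f (suc i)) ∎
  where open ≡-Reasoning

∑∑-∏ : (xs : List A) (ys : List B) (f : Fin m → A → ℤ) (g : Fin n → B → ℤ) →
       ∑[ v ∈ allVecs xs m ] ∑[ w ∈ allVecs ys n ]
         ∏[ a < m ] f a (lookup v a) * ∏[ b < n ] g b (lookup w b)
       ≡ ∏[ a < m ] ∑ xs (f a) * ∏[ b < n ] ∑ ys (g b)
∑∑-∏ {m = m} {n = n} xs ys f g =
  trans (∑∑-separate (allVecs xs m) (allVecs ys n) _ _) (cong₂ _*_ (∑-∏ xs m f) (∑-∏ ys n g))

∑-allVecs-++ : (xs : List A) (m n : ℕ) (φ : Vec A (m + n) → ℤ) →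
               ∑ (allVecs xs (m + n)) φ ≡ ∑[ v ∈ allVecs xs m ] ∑[ w ∈ allVecs xs n ] φ (v Vec.++ w)
∑-allVecs-++ xs zero    n φ = sym (+-identityʳ _)
∑-allVecs-++ xs (suc m) n φ = begin
  ∑ (allVecs xs (suc m + n)) φ
    ≡⟨ ∑-allVecs-suc xs φ ⟩
  ∑[ x ∈ xs ] ∑ (allVecs xs (m + n)) (φ ∘ (x ∷_))
    ≡⟨ ∑-cong xs (λ x → ∑-allVecs-++ xs m n (φ ∘ (x ∷_))) ⟩
  ∑[ x ∈ xs ] ∑[ v ∈ allVecs xs m ] ∑[ w ∈ allVecs xs n ] φ (x ∷ v Vec.++ w)
    ≡⟨ sym (∑-allVecs-suc xs _) ⟩
  ∑[ v ∈ allVecs xs (suc m) ] ∑[ w ∈ allVecs xs n ] φ (v Vec.++ w) ∎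
  where open ≡-Reasoning

slots : (n : ℕ) → List (Maybe (Fin n))
slots n = nothing ∷ List.map just (allFin n)

_≟M_ : DecidableEquality (Maybe (Fin n))
_≟M_ = MaybeP.≡-dec _≟F_

parentVecs-enumerate : ∀ n → Enumerates (_≟PV_ {n}) (allParentVecs n)
parentVecs-enumerate n = vecs-enumerates {_≟_ = _≟M_} (maybe-enumerates {_≟_ = _≟F_} {xs = allFin n} (allFin-enumerates n)) n

∑-forests : (φ : ParentVec n → ℤ) →
            ∑[ F ∈ forests n ] φ (parent F) ≡ ∑[ v ∈ allParentVecs n ] 𝟙 (acyclic? v) * φ v
∑-forests {n} φ = trans (∑-mapMaybe toForest (allParentVecs n) _) (∑-cong (allParentVecs n) toForest-weight)
  where
  toForest-weight : ∀ v → maybe (φ ∘ parent) 0ℤ (toForest v) ≡ 𝟙 (acyclic? v) * φ v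
  toForest-weight v with acyclic? v
  ... | yes acy = sym (trans (cong (_* φ v) (𝟙-yes acy (acyclic? v))) (*-identityˡ (φ v)))
  ... | no ¬acy = sym (cong (_* φ v) (𝟙-no ¬acy (acyclic? v)))

∑-forests-free : (φ : ParentVec n → ℤ) → (∀ v → ¬ IsAcyclic v → φ v ≡ 0ℤ) →
                 ∑[ F ∈ forests n ] φ (parent F) ≡ ∑[ v ∈ allParentVecs n ] φ v
∑-forests-free {n} φ cyclic⇒0 = trans (∑-forests φ) (∑-cong (allParentVecs n) drop-weight)
  where
  drop-weight : ∀ v → 𝟙 (acyclic? v) * φ v ≡ φ v
  drop-weight v with acyclic? v
  ... | yes acy = trans (cong (_* φ v) (𝟙-yes acy (acyclic? v))) (*-identityˡ (φ v))
  ... | no ¬acy = trans (cong (_* φ v) (𝟙-no ¬acy (acyclic? v))) (sym (cyclic⇒0 v ¬acy))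

∑-forests-sift : (G : Forest n) (φ : ParentVec n → ℤ) →
                 ∑[ F ∈ forests n ] 𝟙 (parent G ≟PV parent F) * φ (parent F) ≡ φ (parent G)
∑-forests-sift {n} G φ = begin
  ∑[ F ∈ forests n ] 𝟙 (parent G ≟PV parent F) * φ (parent F)
    ≡⟨ ∑-forests (λ v → 𝟙 (parent G ≟PV v) * φ v) ⟩
  ∑[ v ∈ allParentVecs n ] 𝟙 (acyclic? v) * (𝟙 (parent G ≟PV v) * φ v)
    ≡⟨ ∑-cong (allParentVecs n) (λ v → x∙yz≈y∙xz (𝟙 (acyclic? v)) (𝟙 (parent G ≟PV v)) (φ v)) ⟩
  ∑[ v ∈ allParentVecs n ] 𝟙 (parent G ≟PV v) * (𝟙 (acyclic? v) * φ v)
    ≡⟨ parentVecs-enumerate n (parent G) _ ⟩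
  𝟙 (acyclic? (parent G)) * φ (parent G)
    ≡⟨ cong (_* φ (parent G)) (𝟙-yes (acyclic G) (acyclic? (parent G))) ⟩
  1ℤ * φ (parent G)
    ≡⟨ *-identityˡ _ ⟩
  φ (parent G) ∎
  where open ≡-Reasoning

ΣH-at : {n : ℕ} (xs : List A) (f : A → Hₒ n) (H : Forest n) → ΣH xs f H ≡ ∑[ x ∈ xs ] f x H
ΣH-at []       f H = refl
ΣH-at (x ∷ xs) f H = cong (f x H +ℤ_) (ΣH-at xs f H)

-- Acyclicity

walk-stays-out : (v : ParentVec n) {y : Maybe (Fin n)} {s t : ℕ} → s ≤′ t →
                 iter (step v) s y ≡ nothing → iter (step v) t y ≡ nothing
walk-stays-out v ≤′-refl      out = out
walk-stays-out v (≤′-step le) out = cong (step v) (walk-stays-out v le out)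

orbit-returns : (f : A → A) (x : A) {p q : ℕ} → p < q → iter f p x ≡ iter f q x →
                ∀ t → ∃[ s ] s < q × iter f t x ≡ iter f s x
orbit-returns f x {p} p<q repeat zero = 0 , ℕP.≤-<-trans z≤n p<q , refl
orbit-returns f x {p} p<q repeat (suc t) with orbit-returns f x p<q repeat t
... | s , s<q , xt≡xs with ℕP.m≤n⇒m<n∨m≡n s<q
...   | inj₁ s+1<q  = suc s , s+1<q , cong f xt≡xs
...   | inj₂ refl   = p , p<q , trans (cong f xt≡xs) (sym repeat)

-- a walk that is still inside the forest after n steps has repeated a
-- vertex (pigeonhole), so it stays inside forever
module _ (v : ParentVec n) (i : Fin n) {j : Fin n} (walk-n : iter (step v) n (just i) ≡ just j) where

  private
    x : ℕ → Maybe (Fin n)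
    x t = iter (step v) t (just i)

    inside : ∀ s → s ≤ n → x s ≢ nothing
    inside s s≤n xs≡nothing with () ← trans (sym walk-n) (walk-stays-out v (ℕP.≤⇒≤′ s≤n) xs≡nothing)

    position : Fin (suc n) → Fin n
    position s = fromMaybe j (x (toℕ s))

    position-spec : ∀ s → x (toℕ s) ≡ just (position s)
    position-spec s with x (toℕ s) in xs
    ... | nothing = ⊥-elim (inside (toℕ s) (FinP.toℕ≤pred[n] s) xs)
    ... | just _  = refl

    repeat : ∀ p q → position p ≡ position q → x (toℕ p) ≡ x (toℕ q)
    repeat p q same = trans (position-spec p) (trans (cong just same) (sym (position-spec q)))

  stays-inside : ∀ t → iter (step v) t (just i) ≢ nothing
  stays-inside t out
    with p , q , p<q , same ← FinP.pigeonhole (ℕP.n<1+n n) position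
    with s , s<q , xt≡xs ← orbit-returns (step v) (just i) p<q (repeat p q same) t
    = inside s (ℕP.≤-trans (ℕP.<⇒≤ s<q) (FinP.toℕ≤pred[n] q)) (trans (sym xt≡xs) out)

leaves-by-n : (v : ParentVec n) (i : Fin n) (t : ℕ) →
              iter (step v) t (just i) ≡ nothing → iter (step v) n (just i) ≡ nothing
leaves-by-n {n} v i t out with iter (step v) n (just i) in walk-n
... | nothing = refl
... | just _  = ⊥-elim (stays-inside v i walk-n t out)

_⊆_ : Vec (Maybe (Fin n)) m → Vec (Maybe (Fin n)) m → Set
u ⊆ w = ∀ i → EdgeIn (lookup u i) (lookup w i)

_⊆?_ : (u w : Vec (Maybe (Fin n)) m) → Dec (u ⊆ w)
u ⊆? w = all? (λ i → edgeIn? (lookup u i) (lookup w i))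

⊆-acyclic : (u w : ParentVec n) → u ⊆ w → IsAcyclic w → IsAcyclic u
⊆-acyclic {n} u w u⊆w acyc-w i = below (walk-dominated n) (acyc-w i)
  where
  -- the walk in u follows the walk in w until it leaves the forest
  step-dominated : ∀ {x y : Maybe (Fin n)} → EdgeIn x y → EdgeIn (step u x) (step w y)
  step-dominated {nothing} _    = tt
  step-dominated {just k}  refl = u⊆w k
  walk-dominated : ∀ t → EdgeIn (iter (step u) t (just i)) (iter (step w) t (just i))
  walk-dominated zero    = refl
  walk-dominated (suc t) = step-dominated (walk-dominated t)
  below : ∀ {x y : Maybe (Fin n)} → EdgeIn x y → y ≡ nothing → x ≡ nothing
  below {nothing} _    _ = refl
  below {just _}  refl ()

embedding-acyclic : (e : Fin m → Fin N) (v : ParentVec m) (w : ParentVec N) →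
                    (∀ a → lookup w (e a) ≡ Maybe.map e (lookup v a)) → IsAcyclic w → IsAcyclic v
embedding-acyclic {m} {N} e v w compatible acyc-w a =
  leaves-by-n v a N (map-nothing (trans (sym (walk-image N (just a))) (acyc-w (e a))))
  where
  walk-image : ∀ t y → iter (step w) t (Maybe.map e y) ≡ Maybe.map e (iter (step v) t y)
  walk-image zero    y = refl
  walk-image (suc t) y rewrite walk-image t y with iter (step v) t y
  ... | nothing = refl
  ... | just b  = compatible b
  map-nothing : {y : Maybe (Fin m)} → Maybe.map e y ≡ nothing → y ≡ nothing
  map-nothing {nothing} _ = refl

lookup-concatˡ : (v : ParentVec k) (w : ParentVec n) (a : Fin k) →
                 lookup (concatPV v w) (a ↑ˡ n) ≡ Maybe.map (_↑ˡ n) (lookup v a)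
lookup-concatˡ {n = n} v w a =
  trans (VecP.lookup-++ˡ (Vec.map (Maybe.map (_↑ˡ n)) v) _ a) (VecP.lookup-map a _ v)

lookup-concatʳ : (v : ParentVec k) (w : ParentVec n) (b : Fin n) →
                 lookup (concatPV v w) (k ↑ʳ b) ≡ Maybe.map (k ↑ʳ_) (lookup w b)
lookup-concatʳ {n = n} v w b =
  trans (VecP.lookup-++ʳ (Vec.map (Maybe.map (_↑ˡ n)) v) _ b) (VecP.lookup-map b _ w)

concat-acyclic : (v : ParentVec k) (w : ParentVec n) → IsAcyclic (concatPV v w) → IsAcyclic v × IsAcyclic w
concat-acyclic v w acyc =
  embedding-acyclic _ v (concatPV v w) (lookup-concatˡ v w) acyc ,
  embedding-acyclic _ w (concatPV v w) (lookup-concatʳ v w) acyc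

PartialInverse : (Fin m → Fin N) → (Fin N → Maybe (Fin m)) → Set
PartialInverse {m} {N} e pre = ∀ (t : Fin N) (c : Fin m) → pre t ≡ just c ⇔ e c ≡ t

preˡ : ∀ k {n} → Fin (k + n) → Maybe (Fin k)
preˡ k t = [ just , const nothing ] (splitAt k t)

preʳ : ∀ k {n} → Fin (k + n) → Maybe (Fin n)
preʳ k t = [ const nothing , just ] (splitAt k t)

preˡ-inverse : ∀ k n → PartialInverse (_↑ˡ n) (preˡ k {n})
preˡ-inverse k n t c = mk⇔ to from
  where
  to : preˡ k t ≡ just c → c ↑ˡ n ≡ t
  to eq with splitAt k t in split
  to refl | inj₁ _ = FinP.splitAt⁻¹-↑ˡ split
  from : c ↑ˡ n ≡ t → preˡ k t ≡ just c
  from refl = cong [ just , const nothing ] (FinP.splitAt-↑ˡ k c n)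

preʳ-inverse : ∀ k n → PartialInverse (k ↑ʳ_) (preʳ k {n})
preʳ-inverse k n t c = mk⇔ to from
  where
  to : preʳ k t ≡ just c → k ↑ʳ c ≡ t
  to eq with splitAt k t in split
  to refl | inj₂ _ = FinP.splitAt⁻¹-↑ʳ split
  from : k ↑ʳ c ≡ t → preʳ k t ≡ just c
  from refl = cong [ const nothing , just ] (FinP.splitAt-↑ʳ k n c)

lookup-restrictˡ : ∀ k {n} (u : ParentVec (k + n)) (a : Fin k) →
                   lookup (restrictL k u) a ≡ (lookup u (a ↑ˡ n) >>= preˡ k)
lookup-restrictˡ k {n} u a rewrite (lookup (restrictL k u) a ≡ _) ∋ VecP.lookup∘tabulate _ a
  with lookup u (a ↑ˡ n)
... | nothing = refl
... | just t with splitAt k t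
...   | inj₁ _ = refl
...   | inj₂ _ = refl

lookup-restrictʳ : ∀ k {n} (u : ParentVec (k + n)) (b : Fin n) →
                   lookup (restrictR k u) b ≡ (lookup u (k ↑ʳ b) >>= preʳ k)
lookup-restrictʳ k {n} u b rewrite (lookup (restrictR k u) b ≡ _) ∋ VecP.lookup∘tabulate _ b
  with lookup u (k ↑ʳ b)
... | nothing = refl
... | just t with splitAt k t
...   | inj₁ _ = refl
...   | inj₂ _ = refl

restriction-indicator : ∀ k {n} (v : Vec (Maybe (Fin (k + n))) k) (w : Vec (Maybe (Fin (k + n))) n)
                        (p : ParentVec k) (q : ParentVec n) →
  𝟙 ((restrictL k (v Vec.++ w) ≟PV p) ×-dec (restrictR k (v Vec.++ w) ≟PV q))
  ≡ ∏[ a < k ] 𝟙 ((lookup v a >>= preˡ k) ≟M lookup p a) * ∏[ b < n ] 𝟙 ((lookup w b >>= preʳ k) ≟M lookup q b)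
restriction-indicator k {n} v w p q =
  trans (𝟙-× (restrictL k (v Vec.++ w) ≟PV p) (restrictR k (v Vec.++ w) ≟PV q))
        (cong₂ _*_ (trans (𝟙-vec-eq _≟M_ (restrictL k (v Vec.++ w)) p) (∏-cong _ _ left))
                    (trans (𝟙-vec-eq _≟M_ (restrictR k (v Vec.++ w)) q) (∏-cong _ _ right)))
  where
  left : ∀ a → 𝟙 (lookup (restrictL k (v Vec.++ w)) a ≟M lookup p a) ≡ 𝟙 ((lookup v a >>= preˡ k) ≟M lookup p a)
  left a = cong (λ y → 𝟙 (y ≟M lookup p a))
             (trans (lookup-restrictˡ k (v Vec.++ w) a) (cong (_>>= preˡ k) (VecP.lookup-++ˡ v w a)))
  right : ∀ b → 𝟙 (lookup (restrictR k (v Vec.++ w)) b ≟M lookup q b) ≡ 𝟙 ((lookup w b >>= preʳ k) ≟M lookup q b)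
  right b = cong (λ y → 𝟙 (y ≟M lookup q b))
              (trans (lookup-restrictʳ k (v Vec.++ w) b) (cong (_>>= preʳ k) (VecP.lookup-++ʳ v w b)))

concat-indicator : (v : ParentVec k) (w : ParentVec n) (t : ParentVec (k + n)) →
  𝟙 (concatPV v w ≟PV t)
  ≡ ∏[ a < k ] 𝟙 (Maybe.map (_↑ˡ n) (lookup v a) ≟M lookup t (a ↑ˡ n))
    * ∏[ b < n ] 𝟙 (Maybe.map (k ↑ʳ_) (lookup w b) ≟M lookup t (k ↑ʳ b))
concat-indicator {k} {n} v w t =
  trans (𝟙-vec-eq _≟M_ (concatPV v w) t)
    (trans (∏-split k n _)
      (cong₂ _*_ (∏-cong _ _ (λ a → cong (λ y → 𝟙 (y ≟M lookup t (a ↑ˡ n))) (lookup-concatˡ v w a)))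
                 (∏-cong _ _ (λ b → cong (λ y → 𝟙 (y ≟M lookup t (k ↑ʳ b))) (lookup-concatʳ v w b)))))

-- The Möbius function of the edge-inclusion order

-- one-slot factor: x is the parent slot of a vertex in the larger forest,
-- y in the smaller one (the edges of the smaller are edges of the larger)
μ₁ : Maybe (Fin n) → Maybe (Fin n) → ℤ
μ₁ nothing  nothing  = 1ℤ
μ₁ nothing  (just _) = 0ℤ
μ₁ (just _) nothing  = -1ℤ
μ₁ (just j) (just k) = 𝟙 (j ≟F k)

μ : (w u : Vec (Maybe (Fin n)) m) → ℤ
μ w u = 𝟙 (u ⊆? w) * (- 1ℤ) ^ℤ (edgeCount w ∸ edgeCount u)

edgeCount-mono : (u w : Vec (Maybe (Fin n)) m) → u ⊆ w → edgeCount u ≤ edgeCount w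
edgeCount-mono []            []            _   = z≤n
edgeCount-mono (nothing ∷ u) (nothing ∷ w) u⊆w = edgeCount-mono u w (u⊆w ∘ suc)
edgeCount-mono (nothing ∷ u) (just _ ∷ w)  u⊆w = ℕP.m≤n⇒m≤1+n (edgeCount-mono u w (u⊆w ∘ suc))
edgeCount-mono (just _ ∷ u)  (x ∷ w)       u⊆w with u⊆w zero
... | refl = s≤s (edgeCount-mono u w (u⊆w ∘ suc))

μ-cons : (x y : Maybe (Fin n)) (w u : Vec (Maybe (Fin n)) m) → μ (x ∷ w) (y ∷ u) ≡ μ₁ x y * μ w u
μ-cons x y w u =
  trans (cong (_* ((- 1ℤ) ^ℤ (edgeCount (x ∷ w) ∸ edgeCount (y ∷ u)))) (𝟙-× (edgeIn? y x) (u ⊆? w)))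
        (by-slots x y (u ⊆? w))
  where
  sign : ℤ
  sign = (- 1ℤ) ^ℤ (edgeCount w ∸ edgeCount u)
  -- only a deleted edge (x a parent, y the root) changes the sign
  by-slots : ∀ x y (d : Dec (u ⊆ w)) →
             (𝟙 (edgeIn? y x) * 𝟙 d) * (- 1ℤ) ^ℤ (edgeCount (x ∷ w) ∸ edgeCount (y ∷ u)) ≡ μ₁ x y * (𝟙 d * sign)
  by-slots nothing  nothing  d = *-assoc 1ℤ (𝟙 d) sign
  by-slots nothing  (just _) d = refl
  by-slots (just j) (just k) d = *-assoc (𝟙 (j ≟F k)) (𝟙 d) sign
  by-slots (just _) nothing  (no _)    = refl
  by-slots (just _) nothing  (yes u⊆w) =
    trans (*-identityˡ _)
      (trans (cong ((- 1ℤ) ^ℤ_) (ℕP.+-∸-assoc 1 (edgeCount-mono u w u⊆w)))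
             (cong (-1ℤ *_) (sym (*-identityˡ sign))))

μ-product : (w u : Vec (Maybe (Fin n)) m) → μ w u ≡ ∏[ i < m ] μ₁ (lookup w i) (lookup u i)
μ-product []      []      = refl
μ-product (x ∷ w) (y ∷ u) = trans (μ-cons x y w u) (cong (μ₁ x y *_) (μ-product w u))

μ-split : (t : ParentVec (k + n)) (v : Vec (Maybe (Fin (k + n))) k) (w : Vec (Maybe (Fin (k + n))) n) →
          μ t (v Vec.++ w) ≡ ∏[ a < k ] μ₁ (lookup t (a ↑ˡ n)) (lookup v a) * ∏[ b < n ] μ₁ (lookup t (k ↑ʳ b)) (lookup w b)
μ-split {k} {n} t v w =
  trans (μ-product t (v Vec.++ w))
    (trans (∏-split k n _)
      (cong₂ _*_ (∏-cong _ _ (λ a → cong (μ₁ (lookup t (a ↑ˡ n))) (VecP.lookup-++ˡ v w a)))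
                 (∏-cong _ _ (λ b → cong (μ₁ (lookup t (k ↑ʳ b))) (VecP.lookup-++ʳ v w b)))))

μ-vanishes-on-cycles : {w u : ParentVec n} → IsAcyclic w → ¬ IsAcyclic u → μ w u ≡ 0ℤ
μ-vanishes-on-cycles {w = w} {u} acy-w ¬acy-u =
  cong (_* ((- 1ℤ) ^ℤ (edgeCount w ∸ edgeCount u))) (𝟙-no (λ u⊆w → ¬acy-u (⊆-acyclic u w u⊆w acy-w)) (u ⊆? w))

S-𝟙 : (F G : Forest n) → S F G ≡ 𝟙 (parent G ≟PV parent F)
S-𝟙 F G = trans (if-then-0 (parent G ≟PV parent F) 1ℤ) (*-identityʳ _)

R-μ : (F G : Forest n) → R F G ≡ μ (parent G) (parent F)
R-μ {n} F G = begin
  R F G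
    ≡⟨ ΣH-at (filter (λ K → K ≤F? F) (forests n)) (λ K → sign K ·ℤ S K) G ⟩
  ∑[ K ∈ filter (λ K → K ≤F? F) (forests n) ] sign K * S K G
    ≡⟨ ∑-filter (λ K → K ≤F? F) (forests n) (λ K → sign K * S K G) ⟩
  ∑[ K ∈ forests n ] 𝟙 (K ≤F? F) * (sign K * S K G)
    ≡⟨ ∑-cong (forests n) (λ K → trans (cong (λ s → 𝟙 (K ≤F? F) * (sign K * s)) (S-𝟙 K G))
                                       (x∙yz≈z∙xy (𝟙 (K ≤F? F)) (sign K) _)) ⟩
  ∑[ K ∈ forests n ] 𝟙 (parent G ≟PV parent K) * μ (parent K) (parent F)
    ≡⟨ ∑-forests-sift G (λ v → μ v (parent F)) ⟩
  μ (parent G) (parent F) ∎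
  where
  open ≡-Reasoning
  sign : Forest n → ℤ
  sign K = (- 1ℤ) ^ℤ (∣E∣ K ∸ ∣E∣ F)

∑-slots : (g : Maybe (Fin n) → ℤ) → ∑ (slots n) g ≡ g nothing +ℤ (∑[ t ∈ allFin n ] g (just t))
∑-slots {n} g = cong (g nothing +ℤ_) (∑-map just (allFin n) g)

∑-μ₁-root : (g : Maybe (Fin n) → ℤ) → ∑[ y ∈ slots n ] g y * μ₁ nothing y ≡ g nothing
∑-μ₁-root {n} g = begin
  ∑[ y ∈ slots n ] g y * μ₁ nothing y
    ≡⟨ ∑-slots (λ y → g y * μ₁ nothing y) ⟩
  g nothing * 1ℤ +ℤ (∑[ t ∈ allFin n ] g (just t) * 0ℤ)
    ≡⟨ cong₂ _+ℤ_ (*-identityʳ (g nothing)) (∑-zero (allFin n) _ (λ t → *-zeroʳ (g (just t)))) ⟩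
  g nothing +ℤ 0ℤ
    ≡⟨ +-identityʳ (g nothing) ⟩
  g nothing ∎
  where open ≡-Reasoning

∑-μ₁-edge : (g : Maybe (Fin n) → ℤ) (t : Fin n) → ∑[ y ∈ slots n ] g y * μ₁ (just t) y ≡ g (just t) - g nothing
∑-μ₁-edge {n} g t = begin
  ∑[ y ∈ slots n ] g y * μ₁ (just t) y
    ≡⟨ ∑-slots (λ y → g y * μ₁ (just t) y) ⟩
  g nothing * -1ℤ +ℤ (∑[ s ∈ allFin n ] g (just s) * 𝟙 (t ≟F s))
    ≡⟨ cong₂ _+ℤ_ (trans (*-comm (g nothing) -1ℤ) (-1*i≡-i (g nothing)))
                  (trans (∑-cong (allFin n) (λ s → *-comm (g (just s)) _)) (allFin-enumerates n t (g ∘ just))) ⟩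
  - g nothing +ℤ g (just t)
    ≡⟨ +-comm (- g nothing) (g (just t)) ⟩
  g (just t) - g nothing ∎
  where open ≡-Reasoning

pullback : (Fin N → Maybe (Fin m)) → (Maybe (Fin m) → ℤ) → Maybe (Fin N) → ℤ
pullback pre φ nothing  = φ nothing
pullback pre φ (just t) = maybe (φ ∘ just) 0ℤ (pre t)

∑-fibre : {e : Fin m → Fin N} {pre : Fin N → Maybe (Fin m)} → PartialInverse e pre →
          (t : Fin N) (ψ : Fin m → ℤ) → ∑[ c ∈ allFin m ] 𝟙 (e c ≟F t) * ψ c ≡ maybe ψ 0ℤ (pre t)
∑-fibre {m} {e = e} {pre} inv t ψ with pre t in pre-t
... | just c₀ = trans (∑-cong (allFin m) (λ c → cong (_* ψ c) (𝟙-⇔ (fibre c) (e c ≟F t) (c₀ ≟F c))))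
                      (allFin-enumerates m c₀ ψ)
  where
  fibre : ∀ c → e c ≡ t ⇔ c₀ ≡ c
  fibre c = mk⇔ (λ ec≡t → MaybeP.just-injective (trans (sym pre-t) (Equivalence.from (inv t c) ec≡t)))
                (λ { refl → Equivalence.to (inv t c₀) pre-t })
... | nothing = ∑-zero (allFin m) _ (λ c → cong (_* ψ c) (𝟙-no (outside c) (e c ≟F t)))
  where
  outside : ∀ c → e c ≢ t
  outside c ec≡t with () ← trans (sym pre-t) (Equivalence.from (inv t c) ec≡t)

∑-pullback : {e : Fin m → Fin N} {pre : Fin N → Maybe (Fin m)} → PartialInverse e pre →
             (φ : Maybe (Fin m) → ℤ) (h : Maybe (Fin N)) →
             ∑[ x ∈ slots m ] 𝟙 (Maybe.map e x ≟M h) * φ x ≡ pullback pre φ h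
∑-pullback {m} {e = e} inv φ nothing = begin
  ∑[ x ∈ slots m ] 𝟙 (Maybe.map e x ≟M nothing) * φ x
    ≡⟨ ∑-slots (λ x → 𝟙 (Maybe.map e x ≟M nothing) * φ x) ⟩
  1ℤ * φ nothing +ℤ ∑ (allFin m) (const 0ℤ)
    ≡⟨ cong₂ _+ℤ_ (*-identityˡ (φ nothing)) (∑-zero (allFin m) _ (λ _ → refl)) ⟩
  φ nothing +ℤ 0ℤ
    ≡⟨ +-identityʳ (φ nothing) ⟩
  φ nothing ∎
  where open ≡-Reasoning
∑-pullback {m} {e = e} {pre} inv φ (just t) = begin
  ∑[ x ∈ slots m ] 𝟙 (Maybe.map e x ≟M just t) * φ x
    ≡⟨ ∑-slots (λ x → 𝟙 (Maybe.map e x ≟M just t) * φ x) ⟩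
  0ℤ +ℤ (∑[ c ∈ allFin m ] 𝟙 (e c ≟F t) * φ (just c))
    ≡⟨ +-identityˡ (∑[ c ∈ allFin m ] 𝟙 (e c ≟F t) * φ (just c)) ⟩
  ∑[ c ∈ allFin m ] 𝟙 (e c ≟F t) * φ (just c)
    ≡⟨ ∑-fibre inv t (φ ∘ just) ⟩
  pullback pre φ (just t) ∎
  where open ≡-Reasoning

slot-identity : (pre : Fin N → Maybe (Fin m)) (h : Maybe (Fin N)) (f : Maybe (Fin m)) →
                pullback pre (λ x → μ₁ x f) h ≡ ∑[ y ∈ slots N ] 𝟙 ((y >>= pre) ≟M f) * μ₁ h y
slot-identity pre nothing f = trans (root-slot f) (sym (∑-μ₁-root (λ y → 𝟙 ((y >>= pre) ≟M f))))
  where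
  root-slot : ∀ f → μ₁ nothing f ≡ 𝟙 (nothing ≟M f)
  root-slot nothing  = refl
  root-slot (just _) = refl
slot-identity pre (just t) f = trans (edge-slot (pre t) f) (sym (∑-μ₁-edge (λ y → 𝟙 ((y >>= pre) ≟M f)) t))
  where
  edge-slot : ∀ c f → maybe (λ c → μ₁ (just c) f) 0ℤ c ≡ 𝟙 (c ≟M f) - 𝟙 (nothing ≟M f)
  edge-slot (just c) nothing  = refl
  edge-slot (just c) (just d) = sym (+-identityʳ (𝟙 (c ≟F d)))
  edge-slot nothing  f        = sym (+-inverseʳ (𝟙 (nothing ≟M f)))

-- weights of a vertex on the product side (parent slot x of the factor)
-- and on the restriction side (parent slot y of the forest on [k'+k''])
concatWeight : (Fin m → Fin N) → Maybe (Fin N) → Maybe (Fin m) → Maybe (Fin m) → ℤ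
concatWeight e h f x = 𝟙 (Maybe.map e x ≟M h) * μ₁ x f

restrictWeight : (Fin N → Maybe (Fin m)) → Maybe (Fin N) → Maybe (Fin m) → Maybe (Fin N) → ℤ
restrictWeight pre h f y = 𝟙 ((y >>= pre) ≟M f) * μ₁ h y

coordinate-identity : {e : Fin m → Fin N} {pre : Fin N → Maybe (Fin m)} → PartialInverse e pre →
                      (h : Maybe (Fin N)) (f : Maybe (Fin m)) →
                      ∑ (slots m) (concatWeight e h f) ≡ ∑ (slots N) (restrictWeight pre h f)
coordinate-identity {pre = pre} inv h f = trans (∑-pullback inv (λ x → μ₁ x f) h) (slot-identity pre h f)

module ProductFormula {k' k'' : ℕ} (F' : Forest k') (F'' : Forest k'') (H : Forest (k' + k'')) where

  private
    p₁ = parent F'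
    p₂ = parent F''
    h  = parent H

  slotˡ : Fin k' → Maybe (Fin (k' + k''))
  slotˡ a = lookup h (a ↑ˡ k'')

  slotʳ : Fin k'' → Maybe (Fin (k' + k''))
  slotʳ b = lookup h (k' ↑ʳ b)

  concatˡ : Fin k' → Maybe (Fin k') → ℤ
  concatˡ a = concatWeight (_↑ˡ k'') (slotˡ a) (lookup p₁ a)

  concatʳ : Fin k'' → Maybe (Fin k'') → ℤ
  concatʳ b = concatWeight (k' ↑ʳ_) (slotʳ b) (lookup p₂ b)

  restrictˡ : Fin k' → Maybe (Fin (k' + k'')) → ℤ
  restrictˡ a = restrictWeight (preˡ k') (slotˡ a) (lookup p₁ a)

  restrictʳ : Fin k'' → Maybe (Fin (k' + k'')) → ℤ
  restrictʳ b = restrictWeight (preʳ k') (slotʳ b) (lookup p₂ b)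

  concatTerm : ParentVec k' → ParentVec k'' → ℤ
  concatTerm v w = 𝟙 (concatPV v w ≟PV h) * (μ v p₁ * μ w p₂)

  concatTerm-cyclic : (v : ParentVec k') (w : ParentVec k'') → ¬ (IsAcyclic v × IsAcyclic w) → concatTerm v w ≡ 0ℤ
  concatTerm-cyclic v w ¬acy = cong (_* (μ v p₁ * μ w p₂)) (𝟙-no split-acyclic (concatPV v w ≟PV h))
    where
    split-acyclic : concatPV v w ≢ h
    split-acyclic eq = ¬acy (concat-acyclic v w (subst IsAcyclic (sym eq) (acyclic H)))

  concatTerm-factorises : (v : ParentVec k') (w : ParentVec k'') →
    concatTerm v w ≡ ∏[ a < k' ] concatˡ a (lookup v a) * ∏[ b < k'' ] concatʳ b (lookup w b)
  concatTerm-factorises v w =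
    trans (cong₂ _*_ (concat-indicator v w h) (cong₂ _*_ (μ-product v p₁) (μ-product w p₂)))
          (∏-interchange (λ a → 𝟙 (Maybe.map (_↑ˡ k'') (lookup v a) ≟M slotˡ a))
                         (λ a → μ₁ (lookup v a) (lookup p₁ a))
                         (λ b → 𝟙 (Maybe.map (k' ↑ʳ_) (lookup w b) ≟M slotʳ b))
                         (λ b → μ₁ (lookup w b) (lookup p₂ b)))

  product-side : (R F' · R F'') H ≡ ∏[ a < k' ] ∑ (slots k') (concatˡ a) * ∏[ b < k'' ] ∑ (slots k'') (concatʳ b)
  product-side = begin
    (R F' · R F'') H
      ≡⟨ ∑-cong (forests k') (λ F → ∑-cong (forests k'') (λ G →
           trans (if-then-0 (concatPV (parent F) (parent G) ≟PV h) (R F' F * R F'' G))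
                 (cong (𝟙 (concatPV (parent F) (parent G) ≟PV h) *_) (cong₂ _*_ (R-μ F' F) (R-μ F'' G))))) ⟩
    ∑[ F ∈ forests k' ] ∑[ G ∈ forests k'' ] concatTerm (parent F) (parent G)
      ≡⟨ ∑-cong (forests k') (λ F → ∑-forests-free (concatTerm (parent F))
           (λ w ¬acy → concatTerm-cyclic (parent F) w (¬acy ∘ proj₂))) ⟩
    ∑[ F ∈ forests k' ] ∑[ w ∈ allParentVecs k'' ] concatTerm (parent F) w
      ≡⟨ ∑-forests-free (λ v → ∑[ w ∈ allParentVecs k'' ] concatTerm v w)
           (λ v ¬acy → ∑-zero (allParentVecs k'') _ (λ w → concatTerm-cyclic v w (¬acy ∘ proj₁))) ⟩
    ∑[ v ∈ allParentVecs k' ] ∑[ w ∈ allParentVecs k'' ] concatTerm v w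
      ≡⟨ ∑-cong (allParentVecs k') (λ v → ∑-cong (allParentVecs k'') (concatTerm-factorises v)) ⟩
    ∑[ v ∈ allParentVecs k' ] ∑[ w ∈ allParentVecs k'' ] ∏[ a < k' ] concatˡ a (lookup v a) * ∏[ b < k'' ] concatʳ b (lookup w b)
      ≡⟨ ∑∑-∏ (slots k') (slots k'') concatˡ concatʳ ⟩
    ∏[ a < k' ] ∑ (slots k') (concatˡ a) * ∏[ b < k'' ] ∑ (slots k'') (concatʳ b) ∎
    where open ≡-Reasoning

  restrictTerm : ParentVec (k' + k'') → ℤ
  restrictTerm u = 𝟙 ((restrictL k' u ≟PV p₁) ×-dec (restrictR k' u ≟PV p₂)) * μ h u

  restrictTerm-cyclic : (u : ParentVec (k' + k'')) → ¬ IsAcyclic u → restrictTerm u ≡ 0ℤ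
  restrictTerm-cyclic u ¬acy =
    trans (cong (restricted *_) (μ-vanishes-on-cycles (acyclic H) ¬acy)) (*-zeroʳ restricted)
    where
    restricted : ℤ
    restricted = 𝟙 ((restrictL k' u ≟PV p₁) ×-dec (restrictR k' u ≟PV p₂))

  restrictTerm-factorises : (v : Vec (Maybe (Fin (k' + k''))) k') (w : Vec (Maybe (Fin (k' + k''))) k'') →
    restrictTerm (v Vec.++ w) ≡ ∏[ a < k' ] restrictˡ a (lookup v a) * ∏[ b < k'' ] restrictʳ b (lookup w b)
  restrictTerm-factorises v w =
    trans (cong₂ _*_ (restriction-indicator k' v w p₁ p₂) (μ-split h v w))
          (∏-interchange (λ a → 𝟙 ((lookup v a >>= preˡ k') ≟M lookup p₁ a))
                         (λ a → μ₁ (slotˡ a) (lookup v a))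
                         (λ b → 𝟙 ((lookup w b >>= preʳ k') ≟M lookup p₂ b))
                         (λ b → μ₁ (slotʳ b) (lookup w b)))

  restriction-side : ΣH (filter (restricts? F' F'') (forests (k' + k''))) R H
    ≡ ∏[ a < k' ] ∑ (slots (k' + k'')) (restrictˡ a) * ∏[ b < k'' ] ∑ (slots (k' + k'')) (restrictʳ b)
  restriction-side = begin
    ΣH (filter (restricts? F' F'') (forests (k' + k''))) R H
      ≡⟨ ΣH-at (filter (restricts? F' F'') (forests (k' + k''))) R H ⟩
    ∑[ K ∈ filter (restricts? F' F'') (forests (k' + k'')) ] R K H
      ≡⟨ ∑-filter (restricts? F' F'') (forests (k' + k'')) (λ K → R K H) ⟩
    ∑[ K ∈ forests (k' + k'') ] 𝟙 (restricts? F' F'' K) * R K H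
      ≡⟨ ∑-cong (forests (k' + k'')) (λ K → cong (𝟙 (restricts? F' F'' K) *_) (R-μ K H)) ⟩
    ∑[ K ∈ forests (k' + k'') ] restrictTerm (parent K)
      ≡⟨ ∑-forests-free restrictTerm restrictTerm-cyclic ⟩
    ∑[ u ∈ allParentVecs (k' + k'') ] restrictTerm u
      ≡⟨ ∑-allVecs-++ (slots (k' + k'')) k' k'' restrictTerm ⟩
    ∑[ v ∈ allVecs (slots (k' + k'')) k' ] ∑[ w ∈ allVecs (slots (k' + k'')) k'' ] restrictTerm (v Vec.++ w)
      ≡⟨ ∑-cong (allVecs (slots (k' + k'')) k') (λ v →
           ∑-cong (allVecs (slots (k' + k'')) k'') (restrictTerm-factorises v)) ⟩
    ∑[ v ∈ allVecs (slots (k' + k'')) k' ] ∑[ w ∈ allVecs (slots (k' + k'')) k'' ]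
      ∏[ a < k' ] restrictˡ a (lookup v a) * ∏[ b < k'' ] restrictʳ b (lookup w b)
      ≡⟨ ∑∑-∏ (slots (k' + k'')) (slots (k' + k'')) restrictˡ restrictʳ ⟩
    ∏[ a < k' ] ∑ (slots (k' + k'')) (restrictˡ a) * ∏[ b < k'' ] ∑ (slots (k' + k'')) (restrictʳ b) ∎
    where open ≡-Reasoning

theorem3p4 : (k' k'' : ℕ) (F' : Forest k') (F'' : Forest k'') (H : Forest (k' + k'')) →
    (R F' · R F'') H ≡ ΣH (filter (restricts? F' F'') (forests (k' + k''))) R H
theorem3p4 k' k'' F' F'' H = begin
  (R F' · R F'') H
    ≡⟨ product-side ⟩
  ∏[ a < k' ] ∑ (slots k') (concatˡ a) * ∏[ b < k'' ] ∑ (slots k'') (concatʳ b)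
    ≡⟨ cong₂ _*_ (∏-cong _ _ (λ a → coordinate-identity (preˡ-inverse k' k'') (slotˡ a) (lookup (parent F') a)))
                 (∏-cong _ _ (λ b → coordinate-identity (preʳ-inverse k' k'') (slotʳ b) (lookup (parent F'') b))) ⟩
  ∏[ a < k' ] ∑ (slots (k' + k'')) (restrictˡ a) * ∏[ b < k'' ] ∑ (slots (k' + k'')) (restrictʳ b)
    ≡⟨ restriction-side ⟨
  ΣH (filter (restricts? F' F'') (forests (k' + k''))) R H ∎
  where
  open ≡-Reasoning
  open ProductFormula F' F'' H
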